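{- Let $b\ge1$, $m\ge1$ and $0\le n<bm$. In the exact model, for every $k\ge1$, $$\Pr(\widehat B_{m,n}=k)=\frac{k\Pr(B_{m,n}=k)}{\mathbb E\,B_{m,n}}=\frac{Q_{m,n,0}}{m^n}\,k\Pr(B_{m,n}=k).$$
   Context: Exact model: $m$ cyclically arranged buckets of capacity $b$ and $n$ labelled keys with hash addresses in the buckets, all $m^n$ hash tables equally likely; keys are placed by linear probing with wrap-around. A block is a maximal run of consecutive full buckets followed by a non-full bucket, its length being its number of buckets. $\widehat B_{m,n}$ is the length of the block containing a given bucket in a random table. $B_{m,n}$ is the length of a block chosen uniformly at random among all blocks in all $m^n$ hash tables. $Q_{m,n,0}$ is the number of hash tables with $m$ buckets and $n$ keys whose last bucket is not full. -}

module Defs where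

open import Data.Nat using (ℕ; zero; suc; _+_; _*_; _∸_; _^_; _≡ᵇ_; _<ᵇ_; _≤ᵇ_)
open import Data.Nat.Properties using () renaming (_≟_ to _≟ℕ_)
open import Data.Bool using (Bool; true; false; if_then_else_; not)
open import Data.Fin using (Fin; toℕ)
open import Data.Vec using (Vec; []; _∷_)
open import Data.List using (List; []; _∷_; [_]; map; concatMap; filter; length; upTo; allFin)
open import Data.Nat.ListAction using (sum)
open import Data.Integer using (+_)
open import Data.Rational using (ℚ; 0ℚ; _/_; _÷_; ≢-nonZero)
open import Data.Rational.Properties using () renaming (_≟_ to _≟ℚ_)
open import Relation.Nullary using (yes; no)

-- Total division on ℚ / ℕ-fractions (denominator 0 gives 0; in the
-- theorem all denominators are nonzero, so this convention is harmless).

_÷?_ : ℚ → ℚ → ℚ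
p ÷? q with q ≟ℚ 0ℚ
... | yes _  = 0ℚ
... | no q≢0 = _÷_ p q {{≢-nonZero q≢0}}

frac : ℕ → ℕ → ℚ
frac a zero    = 0ℚ
frac a (suc d) = (+ a) / suc d

-- Hash tables: m buckets (indices 0..m-1, cyclic), capacity b,
-- n labelled keys; a hash table assigns to key i its address h i.

HashTable : ℕ → ℕ → Set
HashTable m n = Vec (Fin m) n

allTables : (m n : ℕ) → List (HashTable m n)
allTables m zero    = [ [] ]
allTables m (suc n) = concatMap (λ i → map (i ∷_) (allTables m n)) (allFin m)

-- occupancy: bucket index ↦ number of keys stored in it
Occ : Set
Occ = ℕ → ℕ

emptyOcc : Occ
emptyOcc _ = 0

bump : ℕ → Occ → Occ
bump p o q = if p ≡ᵇ q then suc (o q) else o q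

nxt : ℕ → ℕ → ℕ
nxt m p = if suc p ≡ᵇ m then 0 else suc p

prv : ℕ → ℕ → ℕ
prv m p = if p ≡ᵇ 0 then m ∸ 1 else p ∸ 1

probe : (m b : ℕ) → ℕ → (fuel : ℕ) → Occ → Occ
probe m b p zero    o = o
probe m b p (suc f) o = if o p <ᵇ b then bump p o else probe m b (nxt m p) f o

fillFrom : (m b : ℕ) → Occ → ∀ {n} → HashTable m n → Occ
fillFrom m b o []       = o
fillFrom m b o (h ∷ hs) = fillFrom m b (probe m b (toℕ h) m o) hs

occupancy : (m b : ℕ) → ∀ {n} → HashTable m n → Occ
occupancy m b t = fillFrom m b emptyOcc t

full : (b : ℕ) → Occ → ℕ → Bool
full b o p = b ≤ᵇ o p

backRun : (m b : ℕ) → Occ → ℕ → (fuel : ℕ) → ℕ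
backRun m b o p zero    = 0
backRun m b o p (suc f) = if full b o p then suc (backRun m b o (prv m p) f) else 0

-- length of the block ending at the non-full bucket e
blockLenEnd : (m b : ℕ) → Occ → ℕ → ℕ
blockLenEnd m b o e = suc (backRun m b o (prv m e) m)

endFrom : (m b : ℕ) → Occ → ℕ → (fuel : ℕ) → ℕ
endFrom m b o p zero    = p
endFrom m b o p (suc f) = if full b o p then endFrom m b o (nxt m p) f else p

blockLenAt : (m b : ℕ) → ∀ {n} → HashTable m n → ℕ → ℕ
blockLenAt m b t j = let o = occupancy m b t in blockLenEnd m b o (endFrom m b o j m)

-- lengths of all blocks of table t (one block per non-full bucket)
blocksOf : (m b : ℕ) → ∀ {n} → HashTable m n → List ℕ
blocksOf m b t =
  let o = occupancy m b t in
  map (blockLenEnd m b o) (filter (λ e → not (full b o e) Data.Bool.≟ true) (upTo m))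

allBlocks : (m b n : ℕ) → List ℕ
allBlocks m b n = concatMap (blocksOf m b) (allTables m n)

countEq : ℕ → List ℕ → ℕ
countEq k xs = length (filter (_≟ℕ k) xs)

-- Pr(B̂_{m,n} = k) for the block containing bucket j
PrHat : (m b n : ℕ) → ℕ → ℕ → ℚ
PrHat m b n j k = frac (length (filter (λ t → blockLenAt m b t j ≟ℕ k) (allTables m n))) (m ^ n)

-- Pr(B_{m,n} = k), block chosen uniformly among all blocks of all tables
PrB : (m b n : ℕ) → ℕ → ℚ
PrB m b n k = frac (countEq k (allBlocks m b n)) (length (allBlocks m b n))

EB : (m b n : ℕ) → ℚ
EB m b n = frac (sum (allBlocks m b n)) (length (allBlocks m b n))

Q0 : (m b n : ℕ) → ℕ
Q0 m b n = length (filter (λ t → full b (occupancy m b t) (m ∸ 1) Data.Bool.≟ false) (allTables m n))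

module Submission where

-- Fix bucket j and length k.  Let A be the number of tables in which the
-- block containing j has length k, and let C, L and S be the number of blocks
-- of length k, the number of blocks and their total length, taken over all
-- blocks of all m^n tables.  Both claimed identities are rational consequences
-- of three counting facts:
--   (i) m · A = k · C,   (ii) S = m^n · m,   (iii) L = m · Q_{m,n,0}.
-- The blocks of a table correspond to its non-full buckets, and (as n < b·m
-- some bucket is not full) they partition its m buckets; more precisely
--   Σ_j g(length of the block of j) = Σ_{e non-full} g(ℓ_e) · ℓ_e     (∗)
-- for every g, proved by telescoping g(block of j) · (offset of j in its block)
-- around the cycle.  (∗) with g = 1 gives (ii).  Shifting every hash address by
-- one bucket permutes the tables and rotates their blocks, so A and the number
-- of tables in which a given bucket is non-full do not depend on the bucket;
-- summing over all m buckets then gives (i) by (∗) with g = [· = k], and (iii).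

open import Defs
open import Data.Nat
open import Data.Nat.Properties
open import Data.Nat.ListAction using (sum)
open import Data.Nat.Tactic.RingSolver using (solve-∀)
open import Data.Bool using (Bool; true; false; if_then_else_; not; T) renaming (_≟_ to _≟𝔹_)
open import Data.Fin using (Fin; toℕ; fromℕ<) renaming (zero to fzero; suc to fsuc)
open import Data.Fin.Properties using (toℕ<n; toℕ-fromℕ<; fromℕ<-toℕ)
open import Data.Vec using ([]; _∷_)
import Data.Vec as Vec
open import Data.List using (List; []; _∷_; [_]; _++_; map; concatMap; filter; length; upTo; allFin; tabulate)
open import Data.List.Properties using (upTo-∷ʳ; map-tabulate; length-tabulate; map-id)
open import Data.Product using (_×_; _,_; ∃)
open import Data.Sum using (_⊎_; inj₁; inj₂)
open import Data.Empty using (⊥-elim)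
open import Data.Unit using (tt)
open import Data.Integer using () renaming (+_ to pos)
import Data.Integer.Properties as ℤ
import Data.Rational
open import Data.Rational using (0ℚ; 1ℚ; 1/_; toℚᵘ; fromℚᵘ) renaming (_*_ to _*ℚ_)
import Data.Rational.Properties as ℚ
open import Data.Rational.Properties using () renaming (_≟_ to _≟ℚ_)
open import Data.Rational.Unnormalised using (mkℚᵘ; *≡*) renaming (_*_ to _*ᵘ_)
import Data.Rational.Unnormalised.Properties as ℚᵘ
open import Relation.Binary.PropositionalEquality hiding ([_])
open import Relation.Nullary using (Dec; yes; no; does)
open import Relation.Unary using (Pred; Decidable)
open import Function using (_∘_; id)
open import Algebra.Properties.CommutativeSemigroup +-commutativeSemigroup using (interchange)
open import Algebra.Properties.CommutativeSemigroup *-commutativeSemigroup using () renaming (x∙yz≈y∙xz to *-left-comm)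
open ≡-Reasoning

ind : Bool → ℕ
ind true  = 1
ind false = 0

ΣL : ∀ {a} {A : Set a} → List A → (A → ℕ) → ℕ
ΣL xs f = sum (map f xs)

Σ< : ℕ → (ℕ → ℕ) → ℕ
Σ< zero    f = 0
Σ< (suc n) f = Σ< n f + f n

ΣL-++ : ∀ {a} {A : Set a} (f : A → ℕ) xs ys → ΣL (xs ++ ys) f ≡ ΣL xs f + ΣL ys f
ΣL-++ f []       ys = refl
ΣL-++ f (x ∷ xs) ys = trans (cong (f x +_) (ΣL-++ f xs ys)) (sym (+-assoc (f x) _ _))

module _ {a} {A : Set a} where

  ΣL-cong : ∀ {f g : A → ℕ} xs → (∀ x → f x ≡ g x) → ΣL xs f ≡ ΣL xs g
  ΣL-cong []       f≗g = refl
  ΣL-cong (x ∷ xs) f≗g = cong₂ _+_ (f≗g x) (ΣL-cong xs f≗g)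

  ΣL-+ : ∀ (f g : A → ℕ) xs → ΣL xs (λ x → f x + g x) ≡ ΣL xs f + ΣL xs g
  ΣL-+ f g []       = refl
  ΣL-+ f g (x ∷ xs) =
    trans (cong (f x + g x +_) (ΣL-+ f g xs)) (interchange (f x) (g x) (ΣL xs f) (ΣL xs g))

  ΣL-*ˡ : ∀ c (f : A → ℕ) xs → ΣL xs (λ x → c * f x) ≡ c * ΣL xs f
  ΣL-*ˡ c f []       = sym (*-zeroʳ c)
  ΣL-*ˡ c f (x ∷ xs) = trans (cong (c * f x +_) (ΣL-*ˡ c f xs)) (sym (*-distribˡ-+ c (f x) _))

  ΣL-const : ∀ c (xs : List A) → ΣL xs (λ _ → c) ≡ length xs * c
  ΣL-const c []       = refl
  ΣL-const c (x ∷ xs) = cong (c +_) (ΣL-const c xs)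

  length≡ΣL : (xs : List A) → length xs ≡ ΣL xs (λ _ → 1)
  length≡ΣL []       = refl
  length≡ΣL (x ∷ xs) = cong suc (length≡ΣL xs)

  length≤ΣL : ∀ (f : A → ℕ) xs → (∀ x → 1 ≤ f x) → length xs ≤ ΣL xs f
  length≤ΣL f []       f≥1 = z≤n
  length≤ΣL f (x ∷ xs) f≥1 = +-mono-≤ (f≥1 x) (length≤ΣL f xs f≥1)

  ΣL-filter : ∀ {p} {P : Pred A p} (P? : Decidable P) (f : A → ℕ) xs →
    ΣL (filter P? xs) f ≡ ΣL xs (λ x → ind (does (P? x)) * f x)
  ΣL-filter P? f []       = refl
  ΣL-filter P? f (x ∷ xs) with does (P? x)
  ... | true  = cong₂ _+_ (sym (+-identityʳ (f x))) (ΣL-filter P? f xs)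
  ... | false = ΣL-filter P? f xs

  length-filter≡ΣL : ∀ {p} {P : Pred A p} (P? : Decidable P) xs →
    length (filter P? xs) ≡ ΣL xs (λ x → ind (does (P? x)))
  length-filter≡ΣL P? xs = begin
    length (filter P? xs)                     ≡⟨ length≡ΣL (filter P? xs) ⟩
    ΣL (filter P? xs) (λ _ → 1)                ≡⟨ ΣL-filter P? (λ _ → 1) xs ⟩
    ΣL xs (λ x → ind (does (P? x)) * 1)        ≡⟨ ΣL-cong xs (λ x → *-identityʳ _) ⟩
    ΣL xs (λ x → ind (does (P? x)))            ∎

  module _ {b} {B : Set b} where

    ΣL-map : ∀ (g : A → B) (f : B → ℕ) xs → ΣL (map g xs) f ≡ ΣL xs (f ∘ g)
    ΣL-map g f []       = refl
    ΣL-map g f (x ∷ xs) = cong (f (g x) +_) (ΣL-map g f xs)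

    ΣL-concatMap : ∀ (g : A → List B) (f : B → ℕ) xs →
      ΣL (concatMap g xs) f ≡ ΣL xs (λ x → ΣL (g x) f)
    ΣL-concatMap g f []       = refl
    ΣL-concatMap g f (x ∷ xs) =
      trans (ΣL-++ f (g x) (concatMap g xs)) (cong (ΣL (g x) f +_) (ΣL-concatMap g f xs))

sum≡ΣL : (xs : List ℕ) → sum xs ≡ ΣL xs id
sum≡ΣL xs = cong sum (sym (map-id xs))

Σ<-cong : ∀ n {f g : ℕ → ℕ} → (∀ j → j < n → f j ≡ g j) → Σ< n f ≡ Σ< n g
Σ<-cong zero    f≗g = refl
Σ<-cong (suc n) f≗g = cong₂ _+_ (Σ<-cong n (λ j j<n → f≗g j (m<n⇒m<1+n j<n))) (f≗g n ≤-refl)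

Σ<-+ : ∀ n (f g : ℕ → ℕ) → Σ< n (λ j → f j + g j) ≡ Σ< n f + Σ< n g
Σ<-+ zero    f g = refl
Σ<-+ (suc n) f g =
  trans (cong (_+ (f n + g n)) (Σ<-+ n f g)) (interchange (Σ< n f) (Σ< n g) (f n) (g n))

Σ<-*ˡ : ∀ n c (f : ℕ → ℕ) → Σ< n (λ j → c * f j) ≡ c * Σ< n f
Σ<-*ˡ zero    c f = sym (*-zeroʳ c)
Σ<-*ˡ (suc n) c f = trans (cong (_+ c * f n) (Σ<-*ˡ n c f)) (sym (*-distribˡ-+ c _ (f n)))

Σ<-const : ∀ n c → Σ< n (λ _ → c) ≡ n * c
Σ<-const zero    c = refl
Σ<-const (suc n) c = trans (cong (_+ c) (Σ<-const n c)) (+-comm (n * c) c)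

Σ<-shift : ∀ (f : ℕ → ℕ) n → f 0 + Σ< n (f ∘ suc) ≡ Σ< (suc n) f
Σ<-shift f zero    = +-identityʳ (f 0)
Σ<-shift f (suc n) = trans (sym (+-assoc (f 0) _ _)) (cong (_+ f (suc n)) (Σ<-shift f n))

Σ<-mono : ∀ n {f g : ℕ → ℕ} → (∀ j → j < n → f j ≤ g j) → Σ< n f ≤ Σ< n g
Σ<-mono zero    f≤g = ≤-refl
Σ<-mono (suc n) f≤g = +-mono-≤ (Σ<-mono n (λ j j<n → f≤g j (m<n⇒m<1+n j<n))) (f≤g n ≤-refl)

term≤Σ< : ∀ n (f : ℕ → ℕ) e → e < n → f e ≤ Σ< n f
term≤Σ< (suc n) f e e<1+n with e ≟ n
... | yes refl = m≤n+m (f e) _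
... | no  e≢n  = ≤-trans (term≤Σ< n f e (≤∧≢⇒< (≤-pred e<1+n) e≢n)) (m≤m+n _ _)

Σ<-ΣL : ∀ {a} {A : Set a} n (f : ℕ → A → ℕ) xs →
  Σ< n (λ j → ΣL xs (f j)) ≡ ΣL xs (λ x → Σ< n (λ j → f j x))
Σ<-ΣL zero    f xs = sym (trans (ΣL-const 0 xs) (*-zeroʳ (length xs)))
Σ<-ΣL (suc n) f xs =
  trans (cong (_+ ΣL xs (f n)) (Σ<-ΣL n f xs)) (sym (ΣL-+ (λ x → Σ< n (λ j → f j x)) (f n) xs))

ΣL-upTo : ∀ (f : ℕ → ℕ) n → ΣL (upTo n) f ≡ Σ< n f
ΣL-upTo f zero    = refl
ΣL-upTo f (suc n) = begin
  ΣL (upTo (suc n)) f          ≡⟨ cong (λ l → ΣL l f) (sym (upTo-∷ʳ n)) ⟩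
  ΣL (upTo n ++ [ n ]) f       ≡⟨ ΣL-++ f (upTo n) [ n ] ⟩
  ΣL (upTo n) f + (f n + 0)    ≡⟨ cong₂ _+_ (ΣL-upTo f n) (+-identityʳ (f n)) ⟩
  Σ< n f + f n                 ∎

ΣL-allFin : ∀ n (h : Fin n → ℕ) (H : ℕ → ℕ) → (∀ i → H (toℕ i) ≡ h i) → ΣL (allFin n) h ≡ Σ< n H
ΣL-allFin zero    h H H≗h = refl
ΣL-allFin (suc n) h H H≗h = begin
  h fzero + ΣL (tabulate fsuc) h               ≡⟨ cong (h fzero +_) tail-reindex ⟩
  h fzero + ΣL (allFin n) (h ∘ fsuc)           ≡⟨ cong₂ _+_ (sym (H≗h fzero)) (ΣL-allFin n (h ∘ fsuc) (H ∘ suc) (H≗h ∘ fsuc)) ⟩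
  H 0 + Σ< n (H ∘ suc)                         ≡⟨ Σ<-shift H n ⟩
  Σ< (suc n) H                                 ∎
  where
  tail-reindex : ΣL (tabulate {n = n} fsuc) h ≡ ΣL (allFin n) (h ∘ fsuc)
  tail-reindex = trans (cong (λ l → ΣL l h) (sym (map-tabulate {n = n} id fsuc))) (ΣL-map fsuc h (allFin n))

if-true : ∀ {a} {A : Set a} {c : Bool} {x y : A} → c ≡ true → (if c then x else y) ≡ x
if-true refl = refl

if-false : ∀ {a} {A : Set a} {c : Bool} {x y : A} → c ≡ false → (if c then x else y) ≡ y
if-false refl = refl

≡ᵇ-true⇒≡ : ∀ {p q} → (p ≡ᵇ q) ≡ true → p ≡ q
≡ᵇ-true⇒≡ {p} {q} e = ≡ᵇ⇒≡ p q (subst T (sym e) tt)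

≡ᵇ-false⇒≢ : ∀ {p q} → (p ≡ᵇ q) ≡ false → p ≢ q
≡ᵇ-false⇒≢ {p} {q} e p≡q = subst T e (≡⇒≡ᵇ p q p≡q)

≡ᵇ-refl : ∀ p → (p ≡ᵇ p) ≡ true
≡ᵇ-refl zero    = refl
≡ᵇ-refl (suc p) = ≡ᵇ-refl p

≢⇒≡ᵇ-false : ∀ {p q} → p ≢ q → (p ≡ᵇ q) ≡ false
≢⇒≡ᵇ-false {p} {q} p≢q with p ≡ᵇ q in e
... | true  = ⊥-elim (p≢q (≡ᵇ-true⇒≡ e))
... | false = refl

nxt-cases : ∀ m p → (suc p ≡ m × nxt m p ≡ 0) ⊎ (suc p ≢ m × nxt m p ≡ suc p)
nxt-cases m p with suc p ≡ᵇ m in e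
... | true  = inj₁ (≡ᵇ-true⇒≡ e , refl)
... | false = inj₂ (≡ᵇ-false⇒≢ e , refl)

nxt-lt : ∀ {m p} → p < m → nxt m p < m
nxt-lt {m} {p} p<m with nxt-cases m p
... | inj₁ (_ , wrap)    rewrite wrap = ≤-trans (s≤s z≤n) p<m
... | inj₂ (p+1≢m , step) rewrite step = ≤∧≢⇒< p<m p+1≢m

nxt-suc : ∀ {m p} → suc p < m → nxt m p ≡ suc p
nxt-suc {m} {p} p+1<m with nxt-cases m p
... | inj₁ (p+1≡m , _) = ⊥-elim (<-irrefl p+1≡m p+1<m)
... | inj₂ (_ , step)  = step

nxt-last : ∀ m' → nxt (suc m') m' ≡ 0
nxt-last m' with nxt-cases (suc m') m'
... | inj₁ (_ , wrap)  = wrap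
... | inj₂ (m'+1≢m'+1 , _) = ⊥-elim (m'+1≢m'+1 refl)

prv-lt : ∀ {m p} → p < m → prv m p < m
prv-lt {suc m'} {zero}  p<m = ≤-refl
prv-lt {m}      {suc p} p<m = <-trans (n<1+n p) p<m

prv-nxt : ∀ {m p} → p < m → prv m (nxt m p) ≡ p
prv-nxt {m} {p} p<m with nxt-cases m p
... | inj₁ (p+1≡m , wrap) rewrite wrap | sym p+1≡m = refl
... | inj₂ (_ , step)     rewrite step = refl

nxt-prv : ∀ {m p} → p < m → nxt m (prv m p) ≡ p
nxt-prv {suc m'} {zero}  p<m = nxt-last m'
nxt-prv {m}      {suc p} p<m = nxt-suc p<m

nxt-injective : ∀ {m p q} → p < m → q < m → nxt m p ≡ nxt m q → p ≡ q
nxt-injective {m} p<m q<m e = trans (sym (prv-nxt p<m)) (trans (cong (prv m) e) (prv-nxt q<m))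

fwd : ℕ → ℕ → ℕ → ℕ
fwd m zero    p = p
fwd m (suc d) p = fwd m d (nxt m p)

bwd : ℕ → ℕ → ℕ → ℕ
bwd m zero    p = p
bwd m (suc d) p = bwd m d (prv m p)

fwd-+ : ∀ m d d' p → fwd m (d + d') p ≡ fwd m d' (fwd m d p)
fwd-+ m zero    d' p = refl
fwd-+ m (suc d) d' p = fwd-+ m d d' (nxt m p)

bwd-+ : ∀ m d d' p → bwd m (d + d') p ≡ bwd m d' (bwd m d p)
bwd-+ m zero    d' p = refl
bwd-+ m (suc d) d' p = bwd-+ m d d' (prv m p)

fwd-linear : ∀ m d p → p + d < m → fwd m d p ≡ p + d
fwd-linear m zero    p _         = sym (+-identityʳ p)
fwd-linear m (suc d) p p+1+d<m = begin
  fwd m d (nxt m p) ≡⟨ cong (fwd m d) (nxt-suc (≤-<-trans (m≤m+n (suc p) d) p+1+d<m')) ⟩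
  fwd m d (suc p)   ≡⟨ fwd-linear m d (suc p) p+1+d<m' ⟩
  suc p + d         ≡⟨ sym (+-suc p d) ⟩
  p + suc d         ∎
  where
  p+1+d<m' : suc p + d < m
  p+1+d<m' = subst (_< m) (+-suc p d) p+1+d<m

bwd-linear : ∀ m d p → d ≤ p → bwd m d p ≡ p ∸ d
bwd-linear m zero    p       _         = refl
bwd-linear m (suc d) (suc p) (s≤s d≤p) = bwd-linear m d p d≤p

fwd-reaches : ∀ m' p e → p < suc m' → e < suc m' → ∃ λ d → d < suc m' × fwd (suc m') d p ≡ e
fwd-reaches m' p e p<m e<m with p ≤? e
... | yes p≤e = e ∸ p , ≤-<-trans (m∸n≤m e p) e<m ,
      trans (fwd-linear (suc m') (e ∸ p) p (subst (_< suc m') (sym (m+[n∸m]≡n p≤e)) e<m)) (m+[n∸m]≡n p≤e)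
... | no  p≰e = m' ∸ p + suc e , s≤s d≤m' , wraps
  where
  p≤m' : p ≤ m'
  p≤m' = ≤-pred p<m
  d≤m' : m' ∸ p + suc e ≤ m'
  d≤m' = ≤-trans (+-monoʳ-≤ (m' ∸ p) (≰⇒> p≰e)) (≤-reflexive (m∸n+n≡m p≤m'))
  wraps : fwd (suc m') (m' ∸ p + suc e) p ≡ e
  wraps = begin
    fwd (suc m') (m' ∸ p + suc e) p
      ≡⟨ fwd-+ (suc m') (m' ∸ p) (suc e) p ⟩
    fwd (suc m') e (nxt (suc m') (fwd (suc m') (m' ∸ p) p))
      ≡⟨ cong (λ z → fwd (suc m') e (nxt (suc m') z))
              (trans (fwd-linear (suc m') (m' ∸ p) p (s≤s (≤-reflexive (m+[n∸m]≡n p≤m')))) (m+[n∸m]≡n p≤m')) ⟩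
    fwd (suc m') e (nxt (suc m') m')
      ≡⟨ cong (fwd (suc m') e) (nxt-last m') ⟩
    fwd (suc m') e 0
      ≡⟨ fwd-linear (suc m') e 0 e<m ⟩
    e ∎

bwd-reaches : ∀ m' p e → p < suc m' → e < suc m' → ∃ λ d → d < suc m' × bwd (suc m') d p ≡ e
bwd-reaches m' p e p<m e<m with e ≤? p
... | yes e≤p = p ∸ e , ≤-<-trans (m∸n≤m p e) p<m ,
      trans (bwd-linear (suc m') (p ∸ e) p (m∸n≤m p e)) (m∸[m∸n]≡n e≤p)
... | no  e≰p = p + suc (m' ∸ e) , s≤s d≤m' , wraps
  where
  e≤m' : e ≤ m'
  e≤m' = ≤-pred e<m
  d≤m' : p + suc (m' ∸ e) ≤ m'
  d≤m' = ≤-trans (≤-reflexive (+-suc p _)) (≤-trans (+-monoˡ-≤ (m' ∸ e) (≰⇒> e≰p)) (≤-reflexive (m+[n∸m]≡n e≤m')))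
  wraps : bwd (suc m') (p + suc (m' ∸ e)) p ≡ e
  wraps = begin
    bwd (suc m') (p + suc (m' ∸ e)) p
      ≡⟨ bwd-+ (suc m') p (suc (m' ∸ e)) p ⟩
    bwd (suc m') (m' ∸ e) (prv (suc m') (bwd (suc m') p p))
      ≡⟨ cong (λ z → bwd (suc m') (m' ∸ e) (prv (suc m') z)) (trans (bwd-linear (suc m') p p ≤-refl) (n∸n≡0 p)) ⟩
    bwd (suc m') (m' ∸ e) m'
      ≡⟨ bwd-linear (suc m') (m' ∸ e) m' (m∸n≤m m' e) ⟩
    m' ∸ (m' ∸ e)
      ≡⟨ m∸[m∸n]≡n e≤m' ⟩
    e ∎

length-allTables : ∀ m n → length (allTables m n) ≡ m ^ n
length-allTables m zero    = refl
length-allTables m (suc n) = begin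
  length (allTables m (suc n))
    ≡⟨ length≡ΣL (allTables m (suc n)) ⟩
  ΣL (allTables m (suc n)) (λ _ → 1)
    ≡⟨ ΣL-concatMap (λ i → map (i ∷_) (allTables m n)) _ (allFin m) ⟩
  ΣL (allFin m) (λ i → ΣL (map (i ∷_) (allTables m n)) (λ _ → 1))
    ≡⟨ ΣL-cong (allFin m) (λ i → trans (ΣL-map (i ∷_) _ (allTables m n)) (sym (length≡ΣL (allTables m n)))) ⟩
  ΣL (allFin m) (λ _ → length (allTables m n))
    ≡⟨ ΣL-const _ (allFin m) ⟩
  length (allFin m) * length (allTables m n)
    ≡⟨ cong₂ _*_ (length-tabulate {n = m} id) (length-allTables m n) ⟩
  m * m ^ n ∎

Σ<-nxt : ∀ m (H : ℕ → ℕ) → Σ< m (H ∘ nxt m) ≡ Σ< m H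
Σ<-nxt zero      H = refl
Σ<-nxt (suc m') H = begin
  Σ< m' (H ∘ nxt (suc m')) + H (nxt (suc m') m')
    ≡⟨ cong₂ _+_ (Σ<-cong m' (λ j j<m' → cong H (nxt-suc (s≤s j<m')))) (cong H (nxt-last m')) ⟩
  Σ< m' (H ∘ suc) + H 0  ≡⟨ +-comm _ (H 0) ⟩
  H 0 + Σ< m' (H ∘ suc)  ≡⟨ Σ<-shift H m' ⟩
  Σ< (suc m') H          ∎

shift-invariant-const : ∀ m (G : ℕ → ℕ) → (∀ j → j < m → G (nxt m j) ≡ G j) → ∀ j → j < m → G j ≡ G 0
shift-invariant-const m G inv zero    _     = refl
shift-invariant-const m G inv (suc j) j+1<m =
  trans (sym (cong G (nxt-suc j+1<m))) (trans (inv j j<m) (shift-invariant-const m G inv j j<m))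
  where
  j<m : j < m
  j<m = <-trans (n<1+n j) j+1<m

Σ<-shift-invariant : ∀ m (G : ℕ → ℕ) → (∀ j → j < m → G (nxt m j) ≡ G j) →
  ∀ j₀ → j₀ < m → Σ< m G ≡ m * G j₀
Σ<-shift-invariant m G inv j₀ j₀<m = begin
  Σ< m G             ≡⟨ Σ<-cong m (λ j j<m → trans (shift-invariant-const m G inv j j<m)
                                                    (sym (shift-invariant-const m G inv j₀ j₀<m))) ⟩
  Σ< m (λ _ → G j₀)  ≡⟨ Σ<-const m (G j₀) ⟩
  m * G j₀           ∎

module Rotation (m b : ℕ) where

  record Shifted (o' o : Occ) : Set where
    constructor shifted
    field at : ∀ q → q < m → o' (nxt m q) ≡ o q
  open Shifted public

  ≡ᵇ-nxt : ∀ {p q} → p < m → q < m → (nxt m p ≡ᵇ nxt m q) ≡ (p ≡ᵇ q)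
  ≡ᵇ-nxt {p} {q} p<m q<m with p ≟ q
  ... | yes refl = trans (≡ᵇ-refl (nxt m p)) (sym (≡ᵇ-refl p))
  ... | no  p≢q  = trans (≢⇒≡ᵇ-false (p≢q ∘ nxt-injective p<m q<m)) (sym (≢⇒≡ᵇ-false p≢q))

  bump-shifted : ∀ {o' o p} → Shifted o' o → p < m → Shifted (bump (nxt m p) o') (bump p o)
  bump-shifted sh p<m = shifted λ q q<m →
    cong₂ (λ c x → if c then suc x else x) (≡ᵇ-nxt p<m q<m) (at sh q q<m)

  probe-shifted : ∀ f {o' o} p → p < m → Shifted o' o → Shifted (probe m b (nxt m p) f o') (probe m b p f o)
  probe-shifted zero    p p<m sh = sh
  probe-shifted (suc f) {o'} {o} p p<m sh rewrite at sh p p<m with o p <ᵇ b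
  ... | true  = bump-shifted sh p<m
  ... | false = probe-shifted f (nxt m p) (nxt-lt p<m) sh

  cyc : Fin m → Fin m
  cyc i = fromℕ< (nxt-lt (toℕ<n i))

  toℕ-cyc : ∀ i → toℕ (cyc i) ≡ nxt m (toℕ i)
  toℕ-cyc i = toℕ-fromℕ< (nxt-lt (toℕ<n i))

  rot : ∀ {n} → HashTable m n → HashTable m n
  rot = Vec.map cyc

  fill-shifted : ∀ {n} (t : HashTable m n) {o' o} → Shifted o' o → Shifted (fillFrom m b o' (rot t)) (fillFrom m b o t)
  fill-shifted []      sh = sh
  fill-shifted (h ∷ t) {o'} {o} sh = fill-shifted t
    (subst (λ a → Shifted (probe m b a m o') (probe m b (toℕ h) m o)) (sym (toℕ-cyc h))
           (probe-shifted m (toℕ h) (toℕ<n h) sh))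

  occupancy-rot : ∀ {n} (t : HashTable m n) → Shifted (occupancy m b (rot t)) (occupancy m b t)
  occupancy-rot t = fill-shifted t (shifted λ _ _ → refl)

  full-shifted : ∀ {o' o} → Shifted o' o → ∀ q → q < m → full b o' (nxt m q) ≡ full b o q
  full-shifted sh q q<m = cong (b ≤ᵇ_) (at sh q q<m)

  endFrom-lt : ∀ o f j → j < m → endFrom m b o j f < m
  endFrom-lt o zero    j j<m = j<m
  endFrom-lt o (suc f) j j<m with full b o j
  ... | true  = endFrom-lt o f (nxt m j) (nxt-lt j<m)
  ... | false = j<m

  endFrom-shifted : ∀ {o' o} → Shifted o' o → ∀ f j → j < m → endFrom m b o' (nxt m j) f ≡ nxt m (endFrom m b o j f)
  endFrom-shifted sh zero    j j<m = refl
  endFrom-shifted {o'} {o} sh (suc f) j j<m rewrite full-shifted sh j j<m with full b o j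
  ... | true  = endFrom-shifted sh f (nxt m j) (nxt-lt j<m)
  ... | false = refl

  prv-nxt-comm : ∀ {p} → p < m → prv m (nxt m p) ≡ nxt m (prv m p)
  prv-nxt-comm p<m = trans (prv-nxt p<m) (sym (nxt-prv p<m))

  backRun-shifted : ∀ {o' o} → Shifted o' o → ∀ f p → p < m → backRun m b o' (nxt m p) f ≡ backRun m b o p f
  backRun-shifted sh zero    p p<m = refl
  backRun-shifted {o'} {o} sh (suc f) p p<m rewrite full-shifted sh p p<m with full b o p
  ... | true  = cong suc (trans (cong (λ q → backRun m b o' q f) (prv-nxt-comm p<m))
                                (backRun-shifted sh f (prv m p) (prv-lt p<m)))
  ... | false = refl

  blockLenAt-rot : ∀ {n} (t : HashTable m n) j → j < m → blockLenAt m b (rot t) (nxt m j) ≡ blockLenAt m b t j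
  blockLenAt-rot t j j<m = begin
    blockLenEnd m b o' (endFrom m b o' (nxt m j) m)      ≡⟨ cong (blockLenEnd m b o') (endFrom-shifted sh m j j<m) ⟩
    blockLenEnd m b o' (nxt m e)                         ≡⟨ cong (λ q → suc (backRun m b o' q m)) (prv-nxt-comm e<m) ⟩
    suc (backRun m b o' (nxt m (prv m e)) m)             ≡⟨ cong suc (backRun-shifted sh m (prv m e) (prv-lt e<m)) ⟩
    blockLenEnd m b o e                                  ∎
    where
    o' o : Occ
    o' = occupancy m b (rot t)
    o  = occupancy m b t
    sh : Shifted o' o
    sh = occupancy-rot t
    e : ℕ
    e = endFrom m b o j m
    e<m : e < m
    e<m = endFrom-lt o m j j<m

  ΣL-allFin-cyc : (h : Fin m → ℕ) → ΣL (allFin m) (h ∘ cyc) ≡ ΣL (allFin m) h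
  ΣL-allFin-cyc h = begin
    ΣL (allFin m) (h ∘ cyc)  ≡⟨ ΣL-allFin m (h ∘ cyc) (H ∘ nxt m) (λ i → trans (cong H (sym (toℕ-cyc i))) (H-toℕ (cyc i))) ⟩
    Σ< m (H ∘ nxt m)         ≡⟨ Σ<-nxt m H ⟩
    Σ< m H                   ≡⟨ sym (ΣL-allFin m h H H-toℕ) ⟩
    ΣL (allFin m) h          ∎
    where
    H : ℕ → ℕ
    H j with j <? m
    ... | yes j<m = h (fromℕ< j<m)
    ... | no  _   = 0
    H-toℕ : ∀ i → H (toℕ i) ≡ h i
    H-toℕ i with toℕ i <? m
    ... | yes i<m = cong h (fromℕ<-toℕ i i<m)
    ... | no  i≮m = ⊥-elim (i≮m (toℕ<n i))

  ΣL-tables-rot : ∀ n (f : HashTable m n → ℕ) → ΣL (allTables m n) (f ∘ rot) ≡ ΣL (allTables m n) f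
  ΣL-tables-rot zero    f = refl
  ΣL-tables-rot (suc n) f = begin
    ΣL (allTables m (suc n)) (f ∘ rot)
      ≡⟨ ΣL-concatMap (λ i → map (i ∷_) (allTables m n)) _ (allFin m) ⟩
    ΣL (allFin m) (λ i → ΣL (map (i ∷_) (allTables m n)) (f ∘ rot))
      ≡⟨ ΣL-cong (allFin m) (λ i → ΣL-map (i ∷_) _ (allTables m n)) ⟩
    ΣL (allFin m) (λ i → ΣL (allTables m n) (λ t → f (cyc i ∷ rot t)))
      ≡⟨ ΣL-cong (allFin m) (λ i → ΣL-tables-rot n (λ t → f (cyc i ∷ t))) ⟩
    ΣL (allFin m) (λ i → ΣL (allTables m n) (λ t → f (cyc i ∷ t)))
      ≡⟨ ΣL-allFin-cyc (λ i → ΣL (allTables m n) (λ t → f (i ∷ t))) ⟩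
    ΣL (allFin m) (λ i → ΣL (allTables m n) (λ t → f (i ∷ t)))
      ≡⟨ ΣL-cong (allFin m) (λ i → sym (ΣL-map (i ∷_) f (allTables m n))) ⟩
    ΣL (allFin m) (λ i → ΣL (map (i ∷_) (allTables m n)) f)
      ≡⟨ sym (ΣL-concatMap (λ i → map (i ∷_) (allTables m n)) f (allFin m)) ⟩
    ΣL (allTables m (suc n)) f ∎

*-suc′ : ∀ x y → x * suc y ≡ x * y + x
*-suc′ x y = trans (*-suc x y) (+-comm x (x * y))

-- Case split on a boolean without abstracting it in the goal.
bool-cases : (c : Bool) → c ≡ true ⊎ c ≡ false
bool-cases true  = inj₁ refl
bool-cases false = inj₂ refl

-- The walks endFrom/backRun stop at e₀ at the latest, so giving
-- them m steps of fuel is enough and more fuel changes nothing.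
module Blocks (m' b : ℕ) (o : Occ) (e₀ : ℕ) (e₀<m : e₀ < suc m') (e₀-nonfull : full b o e₀ ≡ false) where

  m : ℕ
  m = suc m'

  endFrom-nonfull : ∀ {p} → full b o p ≡ false → ∀ f → endFrom m b o p f ≡ p
  endFrom-nonfull p-nonfull zero    = refl
  endFrom-nonfull p-nonfull (suc f) = if-false p-nonfull

  backRun-nonfull : ∀ {p} → full b o p ≡ false → ∀ f → backRun m b o p f ≡ 0
  backRun-nonfull p-nonfull zero    = refl
  backRun-nonfull p-nonfull (suc f) = if-false p-nonfull

  endFrom-fuel : ∀ d p → fwd m d p ≡ e₀ → ∀ f → d ≤ f → endFrom m b o p f ≡ endFrom m b o p d
  endFrom-fuel d p reach f d≤f = trans (cong (endFrom m b o p) (sym (m+[n∸m]≡n d≤f))) (extra d p reach (f ∸ d))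
    where
    extra : ∀ d p → fwd m d p ≡ e₀ → ∀ f → endFrom m b o p (d + f) ≡ endFrom m b o p d
    extra zero    p refl  f = endFrom-nonfull e₀-nonfull f
    extra (suc d) p reach f with full b o p
    ... | true  = extra d (nxt m p) reach f
    ... | false = refl

  backRun-fuel : ∀ d p → bwd m d p ≡ e₀ → ∀ f → d ≤ f → backRun m b o p f ≡ backRun m b o p d
  backRun-fuel d p reach f d≤f = trans (cong (backRun m b o p) (sym (m+[n∸m]≡n d≤f))) (extra d p reach (f ∸ d))
    where
    extra : ∀ d p → bwd m d p ≡ e₀ → ∀ f → backRun m b o p (d + f) ≡ backRun m b o p d
    extra zero    p refl  f = backRun-nonfull e₀-nonfull f
    extra (suc d) p reach f with full b o p
    ... | true  = cong suc (extra d (prv m p) reach f)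
    ... | false = refl

  full≢e₀ : ∀ {j} → full b o j ≡ true → j ≢ e₀
  full≢e₀ j-full refl with trans (sym j-full) e₀-nonfull
  ... | ()

  blockOf : ℕ → ℕ
  blockOf j = blockLenEnd m b o (endFrom m b o j m)

  offset : ℕ → ℕ
  offset j = backRun m b o (prv m j) m

  endFrom-full-step : ∀ j → j < m → full b o j ≡ true → endFrom m b o j m ≡ endFrom m b o (nxt m j) m
  endFrom-full-step j j<m j-full with fwd-reaches m' j e₀ j<m e₀<m
  ... | zero  , _         , reach = ⊥-elim (full≢e₀ j-full reach)
  ... | suc d , s≤s d<m' , reach = begin
    endFrom m b o j m           ≡⟨ if-true j-full ⟩
    endFrom m b o (nxt m j) m'  ≡⟨ endFrom-fuel d (nxt m j) reach m' (<⇒≤ d<m') ⟩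
    endFrom m b o (nxt m j) d   ≡⟨ sym (endFrom-fuel d (nxt m j) reach m (m≤n⇒m≤1+n (<⇒≤ d<m'))) ⟩
    endFrom m b o (nxt m j) m   ∎

  offset-full-step : ∀ j → j < m → full b o j ≡ true → offset (nxt m j) ≡ suc (offset j)
  offset-full-step j j<m j-full with bwd-reaches m' j e₀ j<m e₀<m
  ... | zero  , _         , reach = ⊥-elim (full≢e₀ j-full reach)
  ... | suc d , s≤s d<m' , reach = begin
    backRun m b o (prv m (nxt m j)) m      ≡⟨ cong (λ q → backRun m b o q m) (prv-nxt j<m) ⟩
    backRun m b o j m                      ≡⟨ if-true j-full ⟩
    suc (backRun m b o (prv m j) m')       ≡⟨ cong suc (backRun-fuel d (prv m j) reach m' (<⇒≤ d<m')) ⟩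
    suc (backRun m b o (prv m j) d)        ≡⟨ cong suc (sym (backRun-fuel d (prv m j) reach m (m≤n⇒m≤1+n (<⇒≤ d<m')))) ⟩
    suc (backRun m b o (prv m j) m)        ∎

  offset-nonfull-step : ∀ j → j < m → full b o j ≡ false → offset (nxt m j) ≡ 0
  offset-nonfull-step j j<m j-nonfull =
    trans (cong (λ q → backRun m b o q m) (prv-nxt j<m)) (backRun-nonfull j-nonfull m)

  nonfull : ℕ → ℕ
  nonfull j = ind (not (full b o j))

  -- Σ_j g(block of j) = Σ_{e non-full} g(ℓ_e) · ℓ_e, where ℓ_e is the length of
  -- the block ending at e: every block of length ℓ contains ℓ buckets.  The
  -- potential φ j = g(block of j) · offset j satisfies the one-step identity
  -- `step` below; summing it around the cycle the φ-terms cancel.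
  module _ (g : ℕ → ℕ) where

    φ : ℕ → ℕ
    φ j = g (blockOf j) * offset j

    step : ∀ j → j < m → φ (nxt m j) + nonfull j * (g (blockLenEnd m b o j) * blockLenEnd m b o j) ≡ φ j + g (blockOf j)
    step j j<m with bool-cases (full b o j)
    ... | inj₁ j-full = begin
      φ (nxt m j) + nonfull j * (g ℓ * ℓ)           ≡⟨ cong (λ c → φ (nxt m j) + ind (not c) * (g ℓ * ℓ)) j-full ⟩
      φ (nxt m j) + 0                               ≡⟨ +-identityʳ _ ⟩
      g (blockOf (nxt m j)) * offset (nxt m j)      ≡⟨ cong₂ (λ e x → g (blockLenEnd m b o e) * x)
                                                             (sym (endFrom-full-step j j<m j-full)) (offset-full-step j j<m j-full) ⟩
      g (blockOf j) * suc (offset j)                ≡⟨ *-suc′ (g (blockOf j)) (offset j) ⟩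
      φ j + g (blockOf j)                           ∎
      where
      ℓ : ℕ
      ℓ = blockLenEnd m b o j
    ... | inj₂ j-nonfull = begin
      φ (nxt m j) + nonfull j * (g ℓ * ℓ)           ≡⟨ cong₂ (λ x c → g (blockOf (nxt m j)) * x + ind (not c) * (g ℓ * ℓ))
                                                             (offset-nonfull-step j j<m j-nonfull) j-nonfull ⟩
      g (blockOf (nxt m j)) * 0 + 1 * (g ℓ * ℓ)     ≡⟨ cong₂ _+_ (*-zeroʳ (g (blockOf (nxt m j)))) (*-identityˡ (g ℓ * ℓ)) ⟩
      g ℓ * suc (offset j)                          ≡⟨ *-suc′ (g ℓ) (offset j) ⟩
      g ℓ * offset j + g ℓ                          ≡⟨ cong (λ e → g (blockLenEnd m b o e) * offset j + g (blockLenEnd m b o e))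
                                                             (sym (endFrom-nonfull j-nonfull m)) ⟩
      φ j + g (blockOf j)                           ∎
      where
      ℓ : ℕ
      ℓ = blockLenEnd m b o j

    block-decomposition : Σ< m (g ∘ blockOf) ≡ Σ< m (λ e → nonfull e * (g (blockLenEnd m b o e) * blockLenEnd m b o e))
    block-decomposition = sym (+-cancelˡ-≡ (Σ< m φ) _ _ (begin
      Σ< m φ + Σ< m weighted                      ≡⟨ cong (_+ Σ< m weighted) (sym (Σ<-nxt m φ)) ⟩
      Σ< m (φ ∘ nxt m) + Σ< m weighted            ≡⟨ sym (Σ<-+ m (φ ∘ nxt m) weighted) ⟩
      Σ< m (λ j → φ (nxt m j) + weighted j)       ≡⟨ Σ<-cong m step ⟩
      Σ< m (λ j → φ j + g (blockOf j))            ≡⟨ Σ<-+ m φ (g ∘ blockOf) ⟩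
      Σ< m φ + Σ< m (g ∘ blockOf)                 ∎))
      where
      weighted : ℕ → ℕ
      weighted e = nonfull e * (g (blockLenEnd m b o e) * blockLenEnd m b o e)

bump-below : ∀ p o N → N ≤ p → Σ< N (bump p o) ≡ Σ< N o
bump-below p o N N≤p = Σ<-cong N (λ j j<N → if-false (≢⇒≡ᵇ-false (λ p≡j → <-irrefl (sym p≡j) (<-≤-trans j<N N≤p))))

bump-inside : ∀ p o N → p < N → Σ< N (bump p o) ≡ suc (Σ< N o)
bump-inside p o (suc N) p<N+1 with p ≟ N
... | yes refl = trans (cong₂ _+_ (bump-below p o p ≤-refl) (if-true (≡ᵇ-refl p))) (+-suc _ _)
... | no  p≢N  = cong₂ _+_ (bump-inside p o N (≤∧≢⇒< (≤-pred p<N+1) p≢N)) (if-false (≢⇒≡ᵇ-false p≢N))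

bump-total : ∀ p o N → Σ< N (bump p o) ≤ suc (Σ< N o)
bump-total p o N with p <? N
... | yes p<N = ≤-reflexive (bump-inside p o N p<N)
... | no  p≮N = ≤-trans (≤-reflexive (bump-below p o N (≮⇒≥ p≮N))) (n≤1+n _)

probe-total : ∀ m b p f o N → Σ< N (probe m b p f o) ≤ suc (Σ< N o)
probe-total m b p zero    o N = n≤1+n _
probe-total m b p (suc f) o N with o p <ᵇ b
... | true  = bump-total p o N
... | false = probe-total m b (nxt m p) f o N

fill-total : ∀ m b {n} (t : HashTable m n) o N → Σ< N (fillFrom m b o t) ≤ n + Σ< N o
fill-total m b []               o N = ≤-refl
fill-total m b {suc n} (h ∷ t) o N = ≤-trans (fill-total m b t (probe m b (toℕ h) m o) N)
  (≤-trans (+-monoʳ-≤ n (probe-total m b (toℕ h) m o N)) (≤-reflexive (+-suc n _)))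

occupancy-total : ∀ m b {n} (t : HashTable m n) N → Σ< N (occupancy m b t) ≤ n
occupancy-total m b {n} t N =
  ≤-trans (fill-total m b t emptyOcc N) (≤-reflexive (trans (cong (n +_) (trans (Σ<-const N 0) (*-zeroʳ N))) (+-identityʳ n)))

nonfull-exists : ∀ b m n → n < b * m → (t : HashTable m n) → ∃ λ e → e < m × full b (occupancy m b t) e ≡ false
nonfull-exists b m n n<bm t with anyUpTo? (λ e → full b (occupancy m b t) e ≟𝔹 false) m
... | yes witness = witness
... | no  none    = ⊥-elim (<-irrefl refl (<-≤-trans n<bm (≤-trans (≤-reflexive (*-comm b m)) (≤-trans all-full-total (occupancy-total m b t m)))))
  where
  o : Occ
  o = occupancy m b t
  all-full : ∀ e → e < m → b ≤ o e
  all-full e e<m with bool-cases (full b o e)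
  ... | inj₁ e-full    = ≤ᵇ⇒≤ b (o e) (subst T (sym e-full) tt)
  ... | inj₂ e-nonfull = ⊥-elim (none (e , e<m , e-nonfull))
  all-full-total : m * b ≤ Σ< m o
  all-full-total = ≤-trans (≤-reflexive (sym (Σ<-const m b))) (Σ<-mono m all-full)

-- Fractions a / (d + 1) are computed through unnormalised rationals, where
-- multiplication and equality are given by the usual cross-multiplication.
frac-* : ∀ a d a' d' → frac a (suc d) *ℚ frac a' (suc d') ≡ frac (a * a') (suc d * suc d')
frac-* a d a' d' = begin
  frac a (suc d) *ℚ frac a' (suc d')
    ≡⟨ sym (ℚ.fromℚᵘ-toℚᵘ _) ⟩
  fromℚᵘ (toℚᵘ (frac a (suc d) *ℚ frac a' (suc d')))
    ≡⟨ ℚ.fromℚᵘ-cong (ℚᵘ.≃-trans (ℚ.toℚᵘ-homo-* (frac a (suc d)) (frac a' (suc d')))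
                                  (ℚᵘ.*-cong (ℚ.toℚᵘ-fromℚᵘ (mkℚᵘ (pos a) d)) (ℚ.toℚᵘ-fromℚᵘ (mkℚᵘ (pos a') d')))) ⟩
  fromℚᵘ (mkℚᵘ (pos a) d *ᵘ mkℚᵘ (pos a') d')
    ≡⟨ cong (λ z → fromℚᵘ (mkℚᵘ z (d' + d * suc d'))) (sym (ℤ.pos-* a a')) ⟩
  frac (a * a') (suc d * suc d') ∎

frac-cross : ∀ a d a' d' → a * suc d' ≡ a' * suc d → frac a (suc d) ≡ frac a' (suc d')
frac-cross a d a' d' cross = ℚ.fromℚᵘ-cong {mkℚᵘ (pos a) d} {mkℚᵘ (pos a') d'}
  (*≡* (trans (sym (ℤ.pos-* a (suc d'))) (trans (cong pos cross) (ℤ.pos-* a' (suc d)))))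

frac-pos≢0 : ∀ s l → frac (suc s) (suc l) ≢ 0ℚ
frac-pos≢0 s l eq with ℚᵘ.≃-trans (ℚᵘ.≃-sym (ℚ.toℚᵘ-fromℚᵘ (mkℚᵘ (pos (suc s)) l))) (ℚ.toℚᵘ-cong eq)
... | *≡* cross with ℤ.+-injective (trans (ℤ.pos-* (suc s) 1) (trans cross (sym (ℤ.pos-* 0 (suc l)))))
... | ()

÷?-unique : ∀ p q r → q ≢ 0ℚ → r *ℚ q ≡ p → p ÷? q ≡ r
÷?-unique p q r q≢0 rq≡p with q ≟ℚ 0ℚ
... | yes q≡0 = ⊥-elim (q≢0 q≡0)
... | no  q≢0′ = begin
  p *ℚ 1/ q            ≡⟨ cong (_*ℚ 1/ q) (sym rq≡p) ⟩
  (r *ℚ q) *ℚ 1/ q     ≡⟨ ℚ.*-assoc r q (1/ q) ⟩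
  r *ℚ (q *ℚ 1/ q)     ≡⟨ cong (r *ℚ_) (ℚ.*-inverseʳ q) ⟩
  r *ℚ 1ℚ              ≡⟨ ℚ.*-identityʳ r ⟩
  r                    ∎
  where
  instance
    q-nonZero : Data.Rational.NonZero q
    q-nonZero = Data.Rational.≢-nonZero q≢0′

probability-identities : ∀ A M Q k C L S m → m * A ≡ k * C → S ≡ M * m → L ≡ m * Q → 1 ≤ M → 1 ≤ L → 1 ≤ m →
  (frac A M ≡ (frac k 1 *ℚ frac C L) ÷? frac S L) × (frac A M ≡ (frac Q M *ℚ frac k 1) *ℚ frac C L)
probability-identities A (suc M′) Q k C (suc L′) S (suc m′) mA≡kC S≡Mm L≡mQ _ _ _ = size-biased , via-Q
  where
  M L m : ℕ
  M = suc M′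
  L = suc L′
  m = suc m′

  size-biased : frac A M ≡ (frac k 1 *ℚ frac C L) ÷? frac S L
  size-biased = sym (÷?-unique _ _ _ S/L≢0 (begin
    frac A M *ℚ frac S L          ≡⟨ frac-* A M′ S L′ ⟩
    frac (A * S) (M * L)          ≡⟨ frac-cross (A * S) _ (k * C) _ cross ⟩
    frac (k * C) (1 * L)          ≡⟨ sym (frac-* k 0 C L′) ⟩
    frac k 1 *ℚ frac C L          ∎))
    where
    S/L≢0 : frac S L ≢ 0ℚ
    S/L≢0 S/L≡0 = frac-pos≢0 (m′ + M′ * m) L′ (trans (cong (λ z → frac z L) (sym S≡Mm)) S/L≡0)
    regroup : ∀ A M m L → A * (M * m) * (1 * L) ≡ (m * A) * (M * L)
    regroup = solve-∀
    cross : A * S * (1 * L) ≡ k * C * (M * L)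
    cross = begin
      A * S * (1 * L)           ≡⟨ cong (λ z → A * z * (1 * L)) S≡Mm ⟩
      A * (M * m) * (1 * L)     ≡⟨ regroup A M m L ⟩
      (m * A) * (M * L)         ≡⟨ cong (_* (M * L)) mA≡kC ⟩
      k * C * (M * L)           ∎

  via-Q : frac A M ≡ (frac Q M *ℚ frac k 1) *ℚ frac C L
  via-Q = sym (begin
    (frac Q M *ℚ frac k 1) *ℚ frac C L    ≡⟨ cong (_*ℚ frac C L) (frac-* Q M′ k 0) ⟩
    frac (Q * k) (M * 1) *ℚ frac C L      ≡⟨ frac-* (Q * k) (M′ * 1) C L′ ⟩
    frac (Q * k * C) (M * 1 * L)          ≡⟨ frac-cross (Q * k * C) _ A M′ (sym cross) ⟩
    frac A M                              ∎)
    where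
    regroup₁ : ∀ A M m Q → A * (M * 1 * (m * Q)) ≡ (m * A) * (Q * M)
    regroup₁ = solve-∀
    regroup₂ : ∀ k C Q M → (k * C) * (Q * M) ≡ Q * k * C * M
    regroup₂ = solve-∀
    cross : A * (M * 1 * L) ≡ Q * k * C * M
    cross = begin
      A * (M * 1 * L)           ≡⟨ cong (λ z → A * (M * 1 * z)) L≡mQ ⟩
      A * (M * 1 * (m * Q))     ≡⟨ regroup₁ A M m Q ⟩
      (m * A) * (Q * M)         ≡⟨ cong (_* (Q * M)) mA≡kC ⟩
      (k * C) * (Q * M)         ≡⟨ regroup₂ k C Q M ⟩
      Q * k * C * M             ∎

module Counting (b m' n : ℕ) (n<bm : n < b * suc m') where

  m : ℕ
  m = suc m'

  tables : List (HashTable m n)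
  tables = allTables m n

  nonfullAt : HashTable m n → ℕ → ℕ
  nonfullAt t e = ind (not (full b (occupancy m b t) e))

  blockEnd : HashTable m n → ℕ → ℕ
  blockEnd t e = blockLenEnd m b (occupancy m b t) e

  ΣL-blocksOf : ∀ t (f : ℕ → ℕ) → ΣL (blocksOf m b t) f ≡ Σ< m (λ e → nonfullAt t e * f (blockEnd t e))
  ΣL-blocksOf t f = begin
    ΣL (map (blockEnd t) (filter nonfull? (upTo m))) f                ≡⟨ ΣL-map (blockEnd t) f (filter nonfull? (upTo m)) ⟩
    ΣL (filter nonfull? (upTo m)) (f ∘ blockEnd t)                    ≡⟨ ΣL-filter nonfull? _ (upTo m) ⟩
    ΣL (upTo m) (λ e → ind (does (nonfull? e)) * f (blockEnd t e))    ≡⟨ ΣL-upTo _ m ⟩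
    Σ< m (λ e → ind (does (nonfull? e)) * f (blockEnd t e))           ≡⟨ Σ<-cong m (λ e _ → cong (_* f (blockEnd t e)) (ind-nonfull? e)) ⟩
    Σ< m (λ e → nonfullAt t e * f (blockEnd t e))                     ∎
    where
    nonfull? : ∀ e → Dec (not (full b (occupancy m b t) e) ≡ true)
    nonfull? e = not (full b (occupancy m b t) e) ≟𝔹 true
    ind-nonfull? : ∀ e → ind (does (nonfull? e)) ≡ nonfullAt t e
    ind-nonfull? e with not (full b (occupancy m b t) e)
    ... | true  = refl
    ... | false = refl

  ΣL-allBlocks : ∀ (f : ℕ → ℕ) → ΣL (allBlocks m b n) f ≡ ΣL tables (λ t → Σ< m (λ e → nonfullAt t e * f (blockEnd t e)))
  ΣL-allBlocks f = trans (ΣL-concatMap (blocksOf m b) f tables) (ΣL-cong tables (λ t → ΣL-blocksOf t f))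

  decomposition : ∀ t (g : ℕ → ℕ) →
    Σ< m (g ∘ blockLenAt m b t) ≡ Σ< m (λ e → nonfullAt t e * (g (blockEnd t e) * blockEnd t e))
  decomposition t g with nonfull-exists b m n n<bm t
  ... | e₀ , e₀<m , e₀-nonfull = Blocks.block-decomposition m' b (occupancy m b t) e₀ e₀<m e₀-nonfull g

  total-length : sum (allBlocks m b n) ≡ m ^ n * m
  total-length = begin
    sum (allBlocks m b n)                                        ≡⟨ sum≡ΣL (allBlocks m b n) ⟩
    ΣL (allBlocks m b n) id                                      ≡⟨ ΣL-allBlocks id ⟩
    ΣL tables (λ t → Σ< m (λ e → nonfullAt t e * blockEnd t e))  ≡⟨ ΣL-cong tables per-table ⟩
    ΣL tables (λ _ → m)                                          ≡⟨ ΣL-const m tables ⟩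
    length tables * m                                            ≡⟨ cong (_* m) (length-allTables m n) ⟩
    m ^ n * m                                                    ∎
    where
    per-table : ∀ t → Σ< m (λ e → nonfullAt t e * blockEnd t e) ≡ m
    per-table t = begin
      Σ< m (λ e → nonfullAt t e * blockEnd t e)        ≡⟨ Σ<-cong m (λ e _ → cong (nonfullAt t e *_) (sym (*-identityˡ (blockEnd t e)))) ⟩
      Σ< m (λ e → nonfullAt t e * (1 * blockEnd t e))  ≡⟨ sym (decomposition t (λ _ → 1)) ⟩
      Σ< m (λ _ → 1)                                   ≡⟨ Σ<-const m 1 ⟩
      m * 1                                            ≡⟨ *-identityʳ m ⟩
      m                                                ∎

  nonfullCount : ℕ → ℕ
  nonfullCount e = ΣL tables (λ t → nonfullAt t e)

  nonfullCount-rot : ∀ e → e < m → nonfullCount (nxt m e) ≡ nonfullCount e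
  nonfullCount-rot e e<m = trans (sym (ΣL-tables-rot n (λ t → nonfullAt t (nxt m e))))
    (ΣL-cong tables (λ t → cong (ind ∘ not) (full-shifted (occupancy-rot t) e e<m)))
    where open Rotation m b

  block-count : length (allBlocks m b n) ≡ m * Q0 m b n
  block-count = begin
    length (allBlocks m b n)                              ≡⟨ length≡ΣL (allBlocks m b n) ⟩
    ΣL (allBlocks m b n) (λ _ → 1)                        ≡⟨ ΣL-allBlocks (λ _ → 1) ⟩
    ΣL tables (λ t → Σ< m (λ e → nonfullAt t e * 1))      ≡⟨ ΣL-cong tables (λ t → Σ<-cong m (λ e _ → *-identityʳ _)) ⟩
    ΣL tables (λ t → Σ< m (nonfullAt t))                  ≡⟨ sym (Σ<-ΣL m (λ e t → nonfullAt t e) tables) ⟩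
    Σ< m nonfullCount                                     ≡⟨ Σ<-shift-invariant m nonfullCount nonfullCount-rot m' ≤-refl ⟩
    m * nonfullCount m'                                   ≡⟨ cong (m *_) (sym Q0≡nonfullCount) ⟩
    m * Q0 m b n                                          ∎
    where
    Q0≡nonfullCount : Q0 m b n ≡ nonfullCount m'
    Q0≡nonfullCount = trans (length-filter≡ΣL (λ t → full b (occupancy m b t) m' ≟𝔹 false) tables)
                            (ΣL-cong tables (λ t → ind-last-nonfull (full b (occupancy m b t) m')))
      where
      ind-last-nonfull : ∀ c → ind (does (c ≟𝔹 false)) ≡ ind (not c)
      ind-last-nonfull true  = refl
      ind-last-nonfull false = refl

  block-count-pos : 1 ≤ length (allBlocks m b n)
  block-count-pos = subst (1 ≤_) count≡ (≤-trans (m^n>0 m n) (subst (_≤ ΣL tables blocksIn) (length-allTables m n) (length≤ΣL blocksIn tables has-block)))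
    where
    blocksIn : HashTable m n → ℕ
    blocksIn t = Σ< m (λ e → nonfullAt t e * 1)
    count≡ : ΣL tables blocksIn ≡ length (allBlocks m b n)
    count≡ = sym (trans (length≡ΣL (allBlocks m b n)) (ΣL-allBlocks (λ _ → 1)))
    has-block : ∀ t → 1 ≤ blocksIn t
    has-block t with nonfull-exists b m n n<bm t
    ... | e₀ , e₀<m , e₀-nonfull = ≤-trans (≤-reflexive (cong (λ c → ind (not c) * 1) (sym e₀-nonfull)))
                                           (term≤Σ< m (λ e → nonfullAt t e * 1) e₀ e₀<m)

  -- Indicator of the value k (definitionally ind (does (x ≟ k))).
  is : ℕ → ℕ → ℕ
  is k x = ind (x ≡ᵇ k)

  is-weight : ∀ k x → is k x * x ≡ k * is k x
  is-weight k x with x ≡ᵇ k in x≡ᵇk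
  ... | true  = trans (+-identityʳ x) (trans (≡ᵇ-true⇒≡ x≡ᵇk) (sym (*-identityʳ k)))
  ... | false = sym (*-zeroʳ k)

  hatCount : ℕ → ℕ → ℕ
  hatCount k j = ΣL tables (λ t → is k (blockLenAt m b t j))

  hatCount-rot : ∀ k j → j < m → hatCount k (nxt m j) ≡ hatCount k j
  hatCount-rot k j j<m = trans (sym (ΣL-tables-rot n (λ t → is k (blockLenAt m b t (nxt m j)))))
    (ΣL-cong tables (λ t → cong (is k) (blockLenAt-rot t j j<m)))
    where open Rotation m b

  blocks-of-length : ∀ k t → Σ< m (is k ∘ blockLenAt m b t) ≡ k * Σ< m (λ e → nonfullAt t e * is k (blockEnd t e))
  blocks-of-length k t = begin
    Σ< m (is k ∘ blockLenAt m b t)                             ≡⟨ decomposition t (is k) ⟩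
    Σ< m (λ e → nonfullAt t e * (is k (blockEnd t e) * blockEnd t e))
      ≡⟨ Σ<-cong m (λ e _ → trans (cong (nonfullAt t e *_) (is-weight k (blockEnd t e))) (*-left-comm (nonfullAt t e) k _)) ⟩
    Σ< m (λ e → k * (nonfullAt t e * is k (blockEnd t e)))    ≡⟨ Σ<-*ˡ m k _ ⟩
    k * Σ< m (λ e → nonfullAt t e * is k (blockEnd t e))      ∎

  size-biased : ∀ k j → j < m →
    m * length (filter (λ t → blockLenAt m b t j ≟ k) tables) ≡ k * countEq k (allBlocks m b n)
  size-biased k j j<m = begin
    m * length (filter (λ t → blockLenAt m b t j ≟ k) tables)
      ≡⟨ cong (m *_) (length-filter≡ΣL (λ t → blockLenAt m b t j ≟ k) tables) ⟩
    m * hatCount k j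
      ≡⟨ sym (Σ<-shift-invariant m (hatCount k) (hatCount-rot k) j j<m) ⟩
    Σ< m (hatCount k)
      ≡⟨ Σ<-ΣL m (λ j t → is k (blockLenAt m b t j)) tables ⟩
    ΣL tables (λ t → Σ< m (is k ∘ blockLenAt m b t))
      ≡⟨ ΣL-cong tables (blocks-of-length k) ⟩
    ΣL tables (λ t → k * Σ< m (λ e → nonfullAt t e * is k (blockEnd t e)))
      ≡⟨ ΣL-*ˡ k _ tables ⟩
    k * ΣL tables (λ t → Σ< m (λ e → nonfullAt t e * is k (blockEnd t e)))
      ≡⟨ cong (k *_) (sym (ΣL-allBlocks (is k))) ⟩
    k * ΣL (allBlocks m b n) (is k)
      ≡⟨ cong (k *_) (sym (length-filter≡ΣL (_≟ k) (allBlocks m b n))) ⟩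
    k * countEq k (allBlocks m b n) ∎

theorem10p11 : (b m n : ℕ) → 1 ≤ b → 1 ≤ m → n < b * m →
    (j : Fin m) → (k : ℕ) → 1 ≤ k →
      (PrHat m b n (toℕ j) k ≡ (frac k 1 *ℚ PrB m b n k) ÷? EB m b n)
      × (PrHat m b n (toℕ j) k ≡ (frac (Q0 m b n) (m ^ n) *ℚ frac k 1) *ℚ PrB m b n k)
theorem10p11 b (suc m') n _ _ n<bm j k _ =
  probability-identities _ (m ^ n) (Q0 m b n) k (countEq k (allBlocks m b n)) (length (allBlocks m b n)) (sum (allBlocks m b n)) m
    (size-biased k (toℕ j) (toℕ<n j)) total-length block-count (m^n>0 m n) block-count-pos (s≤s z≤n)
  where open Counting b m' n n<bm
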